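{- Let $G$ be a finite simple graph, let $n\geq 2$ be even, and let $v_1,\dots,v_{n-2},v,v'$ be (not necessarily distinct) vertices of $G$ such that for every vertex $x$ of $G$, $v\sim_G x$ if and only if $v'\sim_G x$. Then $\mathrm{pm}_G(v_1,\dots,v_{n-2},v,v')=\mathrm{pm}_G(v_1,\dots,v_{n-2})$.
   Context: For vertices $x,y$ of $G$, $x\sim_G y$ holds iff $\{x,y\}\in E(G)$ or $x=y$. For an even $m\ge 0$ and a list $w_1,\dots,w_m$ of (not necessarily distinct) vertices, $\mathrm{pm}_G(w_1,\dots,w_m)$ is the Boolean value $\bigoplus_{P}\bigwedge_{\{i,j\}\in P}(w_i\sim_G w_j)$, where $P$ ranges over all partitions of the index set $\{1,\dots,m\}$ into 2-element sets and $\oplus$ is exclusive or; for $m=0$ its value is true. -}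

module Defs where

open import Data.Nat using (ℕ; zero; suc; _+_)
open import Data.Bool using (Bool; true; false; _∧_; _∨_; _xor_; not)
open import Data.Fin using (Fin; zero; suc)
open import Data.Fin.Properties using (_≟_)
open import Data.List using (List; []; _∷_; map; concatMap; foldr)
open import Data.Vec using (Vec; lookup)
open import Data.Product using (Σ)
open import Relation.Nullary.Decidable using (⌊_⌋)
open import Relation.Binary.PropositionalEquality using (_≡_)

record SimpleGraph (N : ℕ) : Set where
  field
    adj   : Fin N → Fin N → Bool
    sym   : ∀ x y → adj x y ≡ adj y x
    irrefl : ∀ x → adj x x ≡ false

open SimpleGraph public

_∼⟨_⟩_ : ∀ {N} → Fin N → SimpleGraph N → Fin N → Bool
x ∼⟨ G ⟩ y = adj G x y ∨ ⌊ x ≟ y ⌋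

Even : ℕ → Set
Even n = Σ ℕ (λ k → n ≡ k + k)

allB : ∀ {A : Set} → (A → Bool) → List A → Bool
allB p = foldr (λ a b → p a ∧ b) true

allFin : (m : ℕ) → List (Fin m)
allFin zero = []
allFin (suc m) = zero ∷ map suc (allFin m)

-- all functions Fin m → Fin k (each exactly once, up to pointwise equality)
extend : ∀ {m k} → Fin k → (Fin m → Fin k) → (Fin (suc m) → Fin k)
extend a f zero = a
extend a f (suc i) = f i

allFuns : (m k : ℕ) → List (Fin m → Fin k)
allFuns zero k = (λ ()) ∷ []
allFuns (suc m) k = concatMap (λ a → map (extend a) (allFuns m k)) (allFin k)

-- A partition of {1..m} into 2-element sets is encoded by its
-- fixed-point-free involution σ (σ i = the partner of i).
isPairing : ∀ {m} → (Fin m → Fin m) → Bool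
isPairing {m} σ = allB (λ i → ⌊ σ (σ i) ≟ i ⌋ ∧ not ⌊ σ i ≟ i ⌋) (allFin m)

-- ⋀_{ {i,j} ∈ P } (w_i ∼ w_j); each pair is visited twice, harmless for ∧.
pairsAdj : ∀ {N m} → SimpleGraph N → Vec (Fin N) m → (Fin m → Fin m) → Bool
pairsAdj {m = m} G w σ = allB (λ i → lookup w i ∼⟨ G ⟩ lookup w (σ i)) (allFin m)

pm : ∀ {N m} → SimpleGraph N → Vec (Fin N) m → Bool
pm {m = m} G w =
  foldr (λ σ b → (isPairing σ ∧ pairsAdj G w σ) xor b) false (allFuns m m)

module Submission where

-- Since allFuns lists every function exactly once
--    up to pointwise equality, a sum over allFuns may be re-indexed along
--    any bijection between the supports of two summands (⨁-reindex), and it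
--    vanishes when an involution of its support flips a Boolean key
--    (⨁-cancel).
-- 2. Weights are invariant under relabelling positions (pm-relabel), so the
--    twins v, v′ may be moved to the front: u = v ∷ v′ ∷ vs.
-- 3. Pairings of u in which v is matched to v′ correspond to pairings of vs,
--    with equal weight because v ∼ v′.  On the remaining ones, exchanging
--    the partners of v and v′ preserves the weight (here the twin
--    hypothesis is used) and swaps which partner is smaller, so they cancel.

open import Defs hiding (sym)
open import Data.Nat using (ℕ; _≤_; _∸_)
open import Data.Fin using (Fin)
open import Data.Vec using (Vec; _++_; _∷_; [])
open import Relation.Binary.PropositionalEquality using (_≡_)

open import Algebra.Bundles using (CommutativeRing)
open import Data.Nat using (zero; suc; _+_)
open import Data.Bool using (Bool; true; false; not; _∧_; _∨_; _xor_)
open import Data.Bool.Properties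
  using ( ⇔→≡; ∧-conicalˡ; ∧-conicalʳ; ∧-identityʳ; ∧-distribˡ-xor
        ; xor-inverseʳ; xor-same; not-involutive; xor-identityʳ; xor-assoc; ∨-zeroʳ
        ; xor-∧-commutativeRing)
open import Algebra.Properties.CommutativeSemigroup
  (CommutativeRing.+-commutativeSemigroup xor-∧-commutativeRing)
  using (interchange)
open import Data.Fin using (zero; suc; splitAt; join; _<?_)
open import Data.Fin.Properties
  using (_≟_; suc-injective; splitAt-join; join-splitAt; <-cmp; <-asym)
open import Data.List using (List; []; _∷_; foldr; map; concatMap)
  renaming (_++_ to _++ᴸ_)
open import Data.Sum using (swap; [_,_]; [_,_]′)
open import Data.Sum.Properties using (swap-involutive)
open import Data.Vec using (lookup)
open import Data.Vec.Properties using (lookup-splitAt)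
open import Function using (_∘_; mk⇔)
open import Relation.Binary.Definitions using (tri<; tri≈; tri>)
open import Relation.Binary.PropositionalEquality
  using (refl; sym; trans; cong; cong₂; _≗_; _≢_; module ≡-Reasoning)
open import Relation.Nullary using (Dec; yes; ¬_; contradiction)
open import Relation.Nullary.Decidable
  using (⌊_⌋; isYes≗does; dec-true; dec-false; does-⇔; ⌊⌋-map′)

private variable
  A B : Set

bool-ext : ∀ {a b : Bool} → (a ≡ true → b ≡ true) → (b ≡ true → a ≡ true) → a ≡ b
bool-ext to from = ⇔→≡ (mk⇔ to from)

∧-intro : ∀ {a b : Bool} → a ≡ true → b ≡ true → a ∧ b ≡ true
∧-intro = cong₂ _∧_

split-by : ∀ a c → a ≡ (a ∧ c) xor (a ∧ not c)
split-by a c = begin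
  a                         ≡⟨ sym (∧-identityʳ a) ⟩
  a ∧ true                  ≡⟨ cong (a ∧_) (sym (xor-inverseʳ c)) ⟩
  a ∧ (c xor not c)         ≡⟨ ∧-distribˡ-xor a c (not c) ⟩
  (a ∧ c) xor (a ∧ not c)   ∎
  where open ≡-Reasoning

⌊⌋-yes : (d : Dec A) → A → ⌊ d ⌋ ≡ true
⌊⌋-yes d a = trans (isYes≗does d) (dec-true d a)

⌊⌋-no : (d : Dec A) → ¬ A → ⌊ d ⌋ ≡ false
⌊⌋-no d ¬a = trans (isYes≗does d) (dec-false d ¬a)

⌊⌋-sound : (d : Dec A) → ⌊ d ⌋ ≡ true → A
⌊⌋-sound (yes a) _ = a

⌊⌋-cong : (A → B) → (B → A) → (d : Dec A) (e : Dec B) → ⌊ d ⌋ ≡ ⌊ e ⌋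
⌊⌋-cong to from d e =
  trans (isYes≗does d) (trans (does-⇔ (mk⇔ to from) d e) (sym (isYes≗does e)))

<?-flip : ∀ {k} {x y : Fin k} → x ≢ y → ⌊ y <? x ⌋ ≡ not ⌊ x <? y ⌋
<?-flip {x = x} {y} x≢y with <-cmp x y
... | tri< x<y _ _ rewrite ⌊⌋-no (y <? x) (<-asym x<y) | ⌊⌋-yes (x <? y) x<y = refl
... | tri≈ _ x≡y _ = contradiction x≡y x≢y
... | tri> _ _ y<x rewrite ⌊⌋-yes (y <? x) y<x | ⌊⌋-no (x <? y) (<-asym y<x) = refl

⨁ : List A → (A → Bool) → Bool
⨁ l f = foldr (λ x b → f x xor b) false l

⨁-cong : ∀ (l : List A) {f g : A → Bool} → f ≗ g → ⨁ l f ≡ ⨁ l g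
⨁-cong []      f≗g = refl
⨁-cong (x ∷ l) f≗g = cong₂ _xor_ (f≗g x) (⨁-cong l f≗g)

⨁-zero : ∀ (l : List A) → ⨁ l (λ _ → false) ≡ false
⨁-zero []      = refl
⨁-zero (x ∷ l) = ⨁-zero l

⨁-xor : ∀ (l : List A) (f g : A → Bool) →
        ⨁ l (λ x → f x xor g x) ≡ ⨁ l f xor ⨁ l g
⨁-xor []      f g = refl
⨁-xor (x ∷ l) f g =
  trans (cong ((f x xor g x) xor_) (⨁-xor l f g)) (interchange (f x) (g x) (⨁ l f) (⨁ l g))

⨁-∧ : ∀ (l : List A) (b : Bool) (f : A → Bool) → b ∧ ⨁ l f ≡ ⨁ l (λ x → b ∧ f x)
⨁-∧ []      true  f = refl
⨁-∧ []      false f = refl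
⨁-∧ (x ∷ l) b     f = trans (∧-distribˡ-xor b (f x) (⨁ l f)) (cong ((b ∧ f x) xor_) (⨁-∧ l b f))

⨁-++ : ∀ (l l′ : List A) (f : A → Bool) → ⨁ (l ++ᴸ l′) f ≡ ⨁ l f xor ⨁ l′ f
⨁-++ []      l′ f = refl
⨁-++ (x ∷ l) l′ f = trans (cong (f x xor_) (⨁-++ l l′ f)) (sym (xor-assoc (f x) (⨁ l f) (⨁ l′ f)))

⨁-map : ∀ (h : A → B) (l : List A) (f : B → Bool) → ⨁ (map h l) f ≡ ⨁ l (f ∘ h)
⨁-map h []      f = refl
⨁-map h (x ∷ l) f = cong (f (h x) xor_) (⨁-map h l f)

⨁-concatMap : ∀ (h : A → List B) (l : List A) (f : B → Bool) →
              ⨁ (concatMap h l) f ≡ ⨁ l (λ x → ⨁ (h x) f)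
⨁-concatMap h []      f = refl
⨁-concatMap h (x ∷ l) f =
  trans (⨁-++ (h x) (concatMap h l) f) (cong (⨁ (h x) f xor_) (⨁-concatMap h l f))

⨁-comm : ∀ (l : List A) (l′ : List B) (f : A → B → Bool) →
         ⨁ l (λ x → ⨁ l′ (f x)) ≡ ⨁ l′ (λ y → ⨁ l (λ x → f x y))
⨁-comm []      l′ f = sym (⨁-zero l′)
⨁-comm (x ∷ l) l′ f =
  trans (cong (⨁ l′ (f x) xor_) (⨁-comm l l′ f)) (sym (⨁-xor l′ (f x) (λ y → ⨁ l (λ x → f x y))))

Fun : ℕ → ℕ → Set
Fun m k = Fin m → Fin k

_≐_ : ∀ {m k} → Fun m k → Fun m k → Bool
_≐_ {zero}  σ τ = true
_≐_ {suc m} σ τ = ⌊ σ zero ≟ τ zero ⌋ ∧ ((σ ∘ suc) ≐ (τ ∘ suc))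

≐-sound : ∀ {m k} (σ τ : Fun m k) → σ ≐ τ ≡ true → σ ≗ τ
≐-sound σ τ eq zero    = ⌊⌋-sound (σ zero ≟ τ zero) (∧-conicalˡ _ _ eq)
≐-sound σ τ eq (suc i) = ≐-sound (σ ∘ suc) (τ ∘ suc) (∧-conicalʳ _ _ eq) i

≐-complete : ∀ {m k} (σ τ : Fun m k) → σ ≗ τ → σ ≐ τ ≡ true
≐-complete {zero}  σ τ σ≗τ = refl
≐-complete {suc m} σ τ σ≗τ =
  ∧-intro (⌊⌋-yes (σ zero ≟ τ zero) (σ≗τ zero)) (≐-complete (σ ∘ suc) (τ ∘ suc) (σ≗τ ∘ suc))

allFin-once : ∀ {k} (x : Fin k) → ⨁ (allFin k) (λ a → ⌊ x ≟ a ⌋) ≡ true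
allFin-once {suc k} zero =
  cong not (trans (⨁-map suc (allFin k) (λ a → ⌊ zero ≟ a ⌋)) (⨁-zero (allFin k)))
allFin-once {suc k} (suc x) =
  trans (⨁-map suc (allFin k) (λ a → ⌊ suc x ≟ a ⌋))
        (trans (⨁-cong (allFin k) (λ a → ⌊⌋-map′ (cong suc) suc-injective (x ≟ a)))
               (allFin-once x))

allFuns-once : ∀ {m k} (σ : Fun m k) → ⨁ (allFuns m k) (σ ≐_) ≡ true
allFuns-once {zero}      σ = refl
allFuns-once {suc m} {k} σ = begin
  ⨁ (allFuns (suc m) k) (σ ≐_)
    ≡⟨ ⨁-concatMap (λ a → map (extend a) (allFuns m k)) (allFin k) (σ ≐_) ⟩
  ⨁ (allFin k) (λ a → ⨁ (map (extend a) (allFuns m k)) (σ ≐_))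
    ≡⟨ ⨁-cong (allFin k) (λ a → ⨁-map (extend a) (allFuns m k) (σ ≐_)) ⟩
  ⨁ (allFin k) (λ a → ⨁ (allFuns m k) (λ τ → ⌊ σ zero ≟ a ⌋ ∧ ((σ ∘ suc) ≐ τ)))
    ≡⟨ ⨁-cong (allFin k) (λ a → sym (⨁-∧ (allFuns m k) ⌊ σ zero ≟ a ⌋ ((σ ∘ suc) ≐_))) ⟩
  ⨁ (allFin k) (λ a → ⌊ σ zero ≟ a ⌋ ∧ ⨁ (allFuns m k) ((σ ∘ suc) ≐_))
    ≡⟨ ⨁-cong (allFin k) (λ a → trans (cong (⌊ σ zero ≟ a ⌋ ∧_) (allFuns-once (σ ∘ suc))) (∧-identityʳ _)) ⟩
  ⨁ (allFin k) (λ a → ⌊ σ zero ≟ a ⌋)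
    ≡⟨ allFin-once (σ zero) ⟩
  true ∎
  where open ≡-Reasoning

point-mass : ∀ {m k} (b : Bool) (σ : Fun m k) → b ≡ ⨁ (allFuns m k) (λ τ → b ∧ (σ ≐ τ))
point-mass {m} {k} b σ =
  trans (sym (∧-identityʳ b)) (trans (cong (b ∧_) (sym (allFuns-once σ))) (⨁-∧ (allFuns m k) b (σ ≐_)))

Extensional : ∀ {m k} → (Fun m k → Bool) → Set
Extensional f = ∀ {σ τ} → σ ≗ τ → f σ ≡ f τ

∧-ext : ∀ {m k} {f g : Fun m k → Bool} → Extensional f → Extensional g →
        Extensional (λ σ → f σ ∧ g σ)
∧-ext f-ext g-ext σ≗τ = cong₂ _∧_ (f-ext σ≗τ) (g-ext σ≗τ)

record SupportBijection {m k m′ k′ : ℕ} (f : Fun m k → Bool) (g : Fun m′ k′ → Bool) : Set where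
  field
    to        : Fun m k → Fun m′ k′
    from      : Fun m′ k′ → Fun m k
    to-cong   : ∀ {σ σ′} → σ ≗ σ′ → to σ ≗ to σ′
    from-cong : ∀ {τ τ′} → τ ≗ τ′ → from τ ≗ from τ′
    to-supp   : ∀ σ → f σ ≡ true → g (to σ) ≡ true
    from-supp : ∀ τ → g τ ≡ true → f (from τ) ≡ true
    from∘to   : ∀ σ → f σ ≡ true → from (to σ) ≗ σ
    to∘from   : ∀ τ → g τ ≡ true → to (from τ) ≗ τ

  inverse : SupportBijection g f
  inverse = record
    { to = from ; from = to ; to-cong = from-cong ; from-cong = to-cong
    ; to-supp = from-supp ; from-supp = to-supp ; from∘to = to∘from ; to∘from = from∘to }

  graph-flip : Extensional g → ∀ σ τ → f σ ∧ (to σ ≐ τ) ≡ true → g τ ∧ (from τ ≐ σ) ≡ true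
  graph-flip g-ext σ τ eq = ∧-intro g-τ (≐-complete (from τ) σ λ i →
    trans (from-cong (sym ∘ to-σ≗τ) i) (from∘to σ f-σ i))
    where
    f-σ    = ∧-conicalˡ _ _ eq
    to-σ≗τ = ≐-sound (to σ) τ (∧-conicalʳ _ _ eq)
    g-τ    = trans (sym (g-ext to-σ≗τ)) (to-supp σ f-σ)

⨁-reindex : ∀ {m k m′ k′} {f : Fun m k → Bool} {g : Fun m′ k′ → Bool} →
            Extensional f → Extensional g → SupportBijection f g →
            ⨁ (allFuns m k) f ≡ ⨁ (allFuns m′ k′) g
⨁-reindex {m} {k} {m′} {k′} {f} {g} f-ext g-ext bij = begin
  ⨁ L f                                          ≡⟨ ⨁-cong L (λ σ → point-mass (f σ) (to σ)) ⟩
  ⨁ L (λ σ → ⨁ L′ (λ τ → f σ ∧ (to σ ≐ τ)))      ≡⟨ ⨁-comm L L′ (λ σ τ → f σ ∧ (to σ ≐ τ)) ⟩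
  ⨁ L′ (λ τ → ⨁ L (λ σ → f σ ∧ (to σ ≐ τ)))      ≡⟨ ⨁-cong L′ (λ τ → ⨁-cong L (λ σ → graph τ σ)) ⟩
  ⨁ L′ (λ τ → ⨁ L (λ σ → g τ ∧ (from τ ≐ σ)))    ≡⟨ ⨁-cong L′ (λ τ → sym (point-mass (g τ) (from τ))) ⟩
  ⨁ L′ g                                         ∎
  where
  open ≡-Reasoning
  open SupportBijection bij
  L  = allFuns m k
  L′ = allFuns m′ k′
  graph : ∀ τ σ → f σ ∧ (to σ ≐ τ) ≡ g τ ∧ (from τ ≐ σ)
  graph τ σ = bool-ext (graph-flip g-ext σ τ) (SupportBijection.graph-flip inverse f-ext τ σ)

record KeyFlip {m k : ℕ} (f key : Fun m k → Bool) : Set where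
  field
    ι             : Fun m k → Fun m k
    ι-cong        : ∀ {σ σ′} → σ ≗ σ′ → ι σ ≗ ι σ′
    ι-involutive  : ∀ σ → f σ ≡ true → ι (ι σ) ≗ σ
    ι-supp        : ∀ σ → f σ ≡ true → f (ι σ) ≡ true
    ι-flips       : ∀ σ → f σ ≡ true → key (ι σ) ≡ not (key σ)

-- Cancellation: such an involution pairs the key-true part of the support
-- with the key-false part, so the sum vanishes.
⨁-cancel : ∀ {m k} {f key : Fun m k → Bool} →
           Extensional f → Extensional key → KeyFlip f key → ⨁ (allFuns m k) f ≡ false
⨁-cancel {m} {k} {f} {key} f-ext key-ext flip = begin
  ⨁ L f                      ≡⟨ ⨁-cong L (λ σ → split-by (f σ) (key σ)) ⟩
  ⨁ L (λ σ → on σ xor off σ) ≡⟨ ⨁-xor L on off ⟩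
  ⨁ L on xor ⨁ L off         ≡⟨ cong (_xor ⨁ L off) (⨁-reindex on-ext off-ext exchange) ⟩
  ⨁ L off xor ⨁ L off        ≡⟨ xor-same (⨁ L off) ⟩
  false                      ∎
  where
  open ≡-Reasoning
  open KeyFlip flip
  L = allFuns m k
  on off : Fun m k → Bool
  on  σ = f σ ∧ key σ
  off σ = f σ ∧ not (key σ)
  on-ext : Extensional on
  on-ext = ∧-ext f-ext key-ext
  off-ext : Extensional off
  off-ext = ∧-ext f-ext (λ σ≗τ → cong not (key-ext σ≗τ))
  to-off : ∀ σ → on σ ≡ true → off (ι σ) ≡ true
  to-off σ eq = ∧-intro (ι-supp σ f-σ)
    (trans (cong not (ι-flips σ f-σ)) (trans (not-involutive (key σ)) (∧-conicalʳ _ _ eq)))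
    where f-σ = ∧-conicalˡ _ _ eq
  to-on : ∀ σ → off σ ≡ true → on (ι σ) ≡ true
  to-on σ eq = ∧-intro (ι-supp σ f-σ) (trans (ι-flips σ f-σ) (∧-conicalʳ _ _ eq))
    where f-σ = ∧-conicalˡ _ _ eq
  exchange : SupportBijection on off
  exchange = record
    { to = ι ; from = ι ; to-cong = ι-cong ; from-cong = ι-cong
    ; to-supp = to-off ; from-supp = to-on
    ; from∘to = λ σ eq → ι-involutive σ (∧-conicalˡ _ _ eq)
    ; to∘from = λ σ eq → ι-involutive σ (∧-conicalˡ _ _ eq) }

allB-cong : ∀ (l : List A) {p q : A → Bool} → p ≗ q → allB p l ≡ allB q l
allB-cong []      p≗q = refl
allB-cong (x ∷ l) p≗q = cong₂ _∧_ (p≗q x) (allB-cong l p≗q)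

allB-map : ∀ (h : A → B) (l : List A) (p : B → Bool) → allB p (map h l) ≡ allB (p ∘ h) l
allB-map h []      p = refl
allB-map h (x ∷ l) p = cong (p (h x) ∧_) (allB-map h l p)

allB-suc : ∀ {M} (p : Fin (suc M) → Bool) →
           allB p (allFin (suc M)) ≡ p zero ∧ allB (p ∘ suc) (allFin M)
allB-suc {M} p = cong (p zero ∧_) (allB-map suc (allFin M) p)

allB-elim : ∀ {M} (p : Fin M → Bool) → allB p (allFin M) ≡ true → ∀ i → p i ≡ true
allB-elim p all zero    = ∧-conicalˡ _ _ all
allB-elim p all (suc i) = allB-elim (p ∘ suc) (∧-conicalʳ _ _ (trans (sym (allB-suc p)) all)) i

allB-suc₂ : ∀ {M} (p : Fin (2 + M) → Bool) →
            allB p (allFin (2 + M)) ≡ p zero ∧ (p (suc zero) ∧ allB (λ i → p (suc (suc i))) (allFin M))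
allB-suc₂ p = trans (allB-suc p) (cong (p zero ∧_) (allB-suc (p ∘ suc)))

allB-intro : ∀ {M} (p : Fin M → Bool) → (∀ i → p i ≡ true) → allB p (allFin M) ≡ true
allB-intro {zero}  p each = refl
allB-intro {suc M} p each = trans (allB-suc p) (∧-intro (each zero) (allB-intro (p ∘ suc) (each ∘ suc)))

allB-reindex : ∀ {M M′} (π : Fin M′ → Fin M) (ρ : Fin M → Fin M′) → (∀ j → π (ρ j) ≡ j) →
               (p : Fin M → Bool) → allB (p ∘ π) (allFin M′) ≡ allB p (allFin M)
allB-reindex π ρ π∘ρ p = bool-ext
  (λ all → allB-intro p (λ j → trans (cong p (sym (π∘ρ j))) (allB-elim (p ∘ π) all (ρ j))))
  (λ all → allB-intro (p ∘ π) (λ i → allB-elim p all (π i)))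

module _ {N : ℕ} (G : SimpleGraph N) where
  ∼-sym : ∀ x y → (x ∼⟨ G ⟩ y) ≡ (y ∼⟨ G ⟩ x)
  ∼-sym x y = cong₂ _∨_ (SimpleGraph.sym G x y) (⌊⌋-cong sym sym (x ≟ y) (y ≟ x))

  ∼-refl : ∀ x → (x ∼⟨ G ⟩ x) ≡ true
  ∼-refl x = trans (cong (adj G x x ∨_) (⌊⌋-yes (x ≟ x) refl)) (∨-zeroʳ _)

  weight : ∀ {M} → Vec (Fin N) M → Fun M M → Bool
  weight w σ = isPairing σ ∧ pairsAdj G w σ

  weight-ext : ∀ {M} (w : Vec (Fin N) M) → Extensional (weight w)
  weight-ext w {σ} {τ} σ≗τ = cong₂ _∧_
    (allB-cong (allFin _) λ i →
      cong₂ (λ a b → ⌊ a ≟ i ⌋ ∧ not ⌊ b ≟ i ⌋) (trans (σ≗τ (σ i)) (cong τ (σ≗τ i))) (σ≗τ i))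
    (allB-cong (allFin _) λ i → cong (λ a → lookup w i ∼⟨ G ⟩ lookup w a) (σ≗τ i))

  weight-closed-nbhd : ∀ {M} (u u′ : Vec (Fin N) M) →
    (∀ i x → (lookup u′ i ∼⟨ G ⟩ x) ≡ (lookup u i ∼⟨ G ⟩ x)) →
    ∀ τ → weight u′ τ ≡ weight u τ
  weight-closed-nbhd u u′ same τ = cong (isPairing τ ∧_) (allB-cong (allFin _) λ i → begin
    lookup u′ i ∼⟨ G ⟩ lookup u′ (τ i)  ≡⟨ same i _ ⟩
    lookup u i ∼⟨ G ⟩ lookup u′ (τ i)   ≡⟨ ∼-sym _ _ ⟩
    lookup u′ (τ i) ∼⟨ G ⟩ lookup u i   ≡⟨ same (τ i) _ ⟩
    lookup u (τ i) ∼⟨ G ⟩ lookup u i    ≡⟨ ∼-sym _ _ ⟩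
    lookup u i ∼⟨ G ⟩ lookup u (τ i)    ∎)
    where open ≡-Reasoning

module _ {M : ℕ} (σ : Fun M M) (pairing : isPairing σ ≡ true) where
  pairing-involutive : ∀ i → σ (σ i) ≡ i
  pairing-involutive i = ⌊⌋-sound (σ (σ i) ≟ i) (∧-conicalˡ _ _ (allB-elim _ pairing i))

  pairing-partner : ∀ {i j} → σ i ≡ j → σ j ≡ i
  pairing-partner {i} σi≡j = trans (cong σ (sym σi≡j)) (pairing-involutive i)

  pairing-fixpoint-free : ∀ i → σ i ≢ i
  pairing-fixpoint-free i σi≡i = contradiction
    (trans (cong not (sym (⌊⌋-yes (σ i ≟ i) σi≡i))) (∧-conicalʳ _ _ (allB-elim _ pairing i)))
    (λ ())

record Relabelling {N M M′ : ℕ} (u : Vec (Fin N) M′) (w : Vec (Fin N) M) : Set where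
  field
    π        : Fin M′ → Fin M
    ρ        : Fin M → Fin M′
    π∘ρ      : ∀ j → π (ρ j) ≡ j
    ρ∘π      : ∀ i → ρ (π i) ≡ i
    lookup-π : ∀ i → lookup u i ≡ lookup w (π i)

module _ {N M M′ : ℕ} (G : SimpleGraph N) {u : Vec (Fin N) M′} {w : Vec (Fin N) M}
         (R : Relabelling u w) where
  open Relabelling R

  weight-relabel : ∀ σ → weight G u (ρ ∘ σ ∘ π) ≡ weight G w σ
  weight-relabel σ = cong₂ _∧_
    (trans (allB-cong (allFin M′) λ i → cong₂ (λ a b → a ∧ not b)
              (trans (≟-ρ _ i) (cong (λ z → ⌊ σ z ≟ π i ⌋) (π∘ρ (σ (π i)))))
              (≟-ρ _ i))
           (allB-reindex π ρ π∘ρ (λ j → ⌊ σ (σ j) ≟ j ⌋ ∧ not ⌊ σ j ≟ j ⌋)))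
    (trans (allB-cong (allFin M′) λ i → cong₂ (λ a b → a ∼⟨ G ⟩ b)
              (lookup-π i) (trans (lookup-π _) (cong (lookup w) (π∘ρ _))))
           (allB-reindex π ρ π∘ρ (λ j → lookup w j ∼⟨ G ⟩ lookup w (σ j))))
    where
    ≟-ρ : ∀ x i → ⌊ ρ x ≟ i ⌋ ≡ ⌊ x ≟ π i ⌋
    ≟-ρ x i = ⌊⌋-cong (λ e → trans (sym (π∘ρ x)) (cong π e)) (λ e → trans (cong ρ e) (ρ∘π i)) _ _

  pm-relabel : pm G u ≡ pm G w
  pm-relabel = ⨁-reindex (weight-ext G u) (weight-ext G w) record
    { to        = λ τ → π ∘ τ ∘ ρ
    ; from      = λ σ → ρ ∘ σ ∘ π
    ; to-cong   = λ τ≗τ′ j → cong π (τ≗τ′ (ρ j))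
    ; from-cong = λ σ≗σ′ i → cong ρ (σ≗σ′ (π i))
    ; to-supp   = λ τ supp → trans (sym (weight-relabel (π ∘ τ ∘ ρ)))
                                   (trans (weight-ext G u (ρπ-cancel τ)) supp)
    ; from-supp = λ σ supp → trans (weight-relabel σ) supp
    ; from∘to   = λ τ _ → ρπ-cancel τ
    ; to∘from   = λ σ _ j → trans (π∘ρ _) (cong σ (π∘ρ j))
    }
    where
    ρπ-cancel : ∀ τ → ρ ∘ (π ∘ τ ∘ ρ) ∘ π ≗ τ
    ρπ-cancel τ i = trans (ρ∘π _) (cong τ (ρ∘π i))

++-swap : ∀ {N a b} (xs : Vec (Fin N) a) (ys : Vec (Fin N) b) → Relabelling (xs ++ ys) (ys ++ xs)
++-swap {a = a} {b} xs ys = record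
  { π        = join b a ∘ swap ∘ splitAt a
  ; ρ        = join a b ∘ swap ∘ splitAt b
  ; π∘ρ      = λ j → swap-back b a j
  ; ρ∘π      = λ i → swap-back a b i
  ; lookup-π = λ i → let s = splitAt a i in begin
      lookup (xs ++ ys) i
        ≡⟨ lookup-splitAt a xs ys i ⟩
      [ lookup xs , lookup ys ]′ s
        ≡⟨ [,]′-swap s ⟩
      [ lookup ys , lookup xs ]′ (swap s)
        ≡⟨ cong [ lookup ys , lookup xs ]′ (sym (splitAt-join b a (swap s))) ⟩
      [ lookup ys , lookup xs ]′ (splitAt b (join b a (swap s)))
        ≡⟨ sym (lookup-splitAt b ys xs (join b a (swap s))) ⟩
      lookup (ys ++ xs) (join b a (swap s)) ∎
  }
  where
  open ≡-Reasoning
  swap-back : ∀ c d (j : Fin (c + d)) →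
              join c d (swap (splitAt d (join d c (swap (splitAt c j))))) ≡ j
  swap-back c d j = let s = splitAt c j in begin
    join c d (swap (splitAt d (join d c (swap s))))  ≡⟨ cong (join c d ∘ swap) (splitAt-join d c (swap s)) ⟩
    join c d (swap (swap s))                          ≡⟨ cong (join c d) (swap-involutive s) ⟩
    join c d s                                        ≡⟨ join-splitAt c d j ⟩
    j                                                 ∎
  [,]′-swap : ∀ {C : Set} {f : Fin a → C} {g : Fin b → C} s → [ f , g ]′ s ≡ [ g , f ]′ (swap s)
  [,]′-swap = [ (λ _ → refl) , (λ _ → refl) ]

module _ {m : ℕ} where
  swap₀₁ : Fun (2 + m) (2 + m)
  swap₀₁ zero          = suc zero
  swap₀₁ (suc zero)    = zero
  swap₀₁ (suc (suc i)) = suc (suc i)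

  swap₀₁-involutive : ∀ i → swap₀₁ (swap₀₁ i) ≡ i
  swap₀₁-involutive zero          = refl
  swap₀₁-involutive (suc zero)    = refl
  swap₀₁-involutive (suc (suc i)) = refl

  swap₀₁-fixes : ∀ x → x ≢ zero → x ≢ suc zero → swap₀₁ x ≡ x
  swap₀₁-fixes zero          x≢0 x≢1 = contradiction refl x≢0
  swap₀₁-fixes (suc zero)    x≢0 x≢1 = contradiction refl x≢1
  swap₀₁-fixes (suc (suc i)) x≢0 x≢1 = refl

  pairFirstTwo : Fun m m → Fun (2 + m) (2 + m)
  pairFirstTwo τ zero          = suc zero
  pairFirstTwo τ (suc zero)    = zero
  pairFirstTwo τ (suc (suc i)) = suc (suc (τ i))

  shiftDown : Fin (2 + m) → Fin m → Fin m
  shiftDown (suc (suc j)) d = j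
  shiftDown _             d = d

  shiftDown-spec : ∀ (x : Fin (2 + m)) d → x ≢ zero → x ≢ suc zero → suc (suc (shiftDown x d)) ≡ x
  shiftDown-spec zero          d x≢0 x≢1 = contradiction refl x≢0
  shiftDown-spec (suc zero)    d x≢0 x≢1 = contradiction refl x≢1
  shiftDown-spec (suc (suc j)) d x≢0 x≢1 = refl

  dropFirstTwo : Fun (2 + m) (2 + m) → Fun m m
  dropFirstTwo σ i = shiftDown (σ (suc (suc i))) i

  pairFirstTwo-drop : ∀ {σ} → isPairing σ ≡ true → σ zero ≡ suc zero →
                      pairFirstTwo (dropFirstTwo σ) ≗ σ
  pairFirstTwo-drop {σ} pairing σ0≡1 zero          = sym σ0≡1
  pairFirstTwo-drop {σ} pairing σ0≡1 (suc zero)    = sym (pairing-partner σ pairing σ0≡1)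
  pairFirstTwo-drop {σ} pairing σ0≡1 (suc (suc i)) = shiftDown-spec _ i
    (λ σx≡0 → 2+i≢1 (trans (sym (pairing-partner σ pairing σx≡0)) σ0≡1))
    (λ σx≡1 → 2+i≢0 (trans (sym (pairing-partner σ pairing σx≡1)) (pairing-partner σ pairing σ0≡1)))
    where
    2+i≢0 : suc (suc i) ≢ zero
    2+i≢0 ()
    2+i≢1 : suc (suc i) ≢ suc zero
    2+i≢1 ()

  record OutsidePartners (σ : Fun (2 + m) (2 + m)) : Set where
    field
      first-fixed   : swap₀₁ (σ zero) ≡ σ zero
      second-fixed  : swap₀₁ (σ (suc zero)) ≡ σ (suc zero)
      second-not-1  : σ (suc zero) ≢ suc zero
      distinct      : σ zero ≢ σ (suc zero)

  outside-partners : ∀ {σ} → isPairing σ ≡ true → σ zero ≢ suc zero → OutsidePartners σ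
  outside-partners {σ} pairing σ0≢1 = record
    { first-fixed  = swap₀₁-fixes _ (pairing-fixpoint-free σ pairing zero) σ0≢1
    ; second-fixed = swap₀₁-fixes _ σ1≢0 (pairing-fixpoint-free σ pairing (suc zero))
    ; second-not-1 = pairing-fixpoint-free σ pairing (suc zero)
    ; distinct     = λ σ0≡σ1 → 0≢1 (trans (sym (pairing-involutive σ pairing zero))
                                   (trans (cong σ σ0≡σ1) (pairing-involutive σ pairing (suc zero))))
    }
    where
    σ1≢0 : σ (suc zero) ≢ zero
    σ1≢0 σ1≡0 = σ0≢1 (pairing-partner σ pairing σ1≡0)
    0≢1 : zero ≢ suc zero
    0≢1 ()

≟-suc₂ : ∀ {k} (x y : Fin k) → ⌊ suc (suc x) ≟ suc (suc y) ⌋ ≡ ⌊ x ≟ y ⌋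
≟-suc₂ x y = ⌊⌋-cong (suc-injective ∘ suc-injective) (cong (λ z → suc (suc z))) _ _

module Twins {N m : ℕ} (G : SimpleGraph N) (vs : Vec (Fin N) m) (v v′ : Fin N) where
  u : Vec (Fin N) (2 + m)
  u = v ∷ v′ ∷ vs

  matched : Fun (2 + m) (2 + m) → Bool
  matched σ = ⌊ σ zero ≟ suc zero ⌋

  matched-ext : Extensional matched
  matched-ext σ≗τ = cong (λ x → ⌊ x ≟ suc zero ⌋) (σ≗τ zero)

  weight-pairFirstTwo : (v ∼⟨ G ⟩ v′) ≡ true → ∀ τ → weight G u (pairFirstTwo τ) ≡ weight G vs τ
  weight-pairFirstTwo v∼v′ τ = cong₂ _∧_
    (trans (allB-suc₂ p) (allB-cong (allFin m) λ i →
      cong₂ (λ a b → a ∧ not b) (≟-suc₂ (τ (τ i)) i) (≟-suc₂ (τ i) i)))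
    (trans (allB-suc₂ q) (cong₂ (λ a b → a ∧ (b ∧ pairsAdj G vs τ)) v∼v′ (trans (∼-sym G v′ v) v∼v′)))
    where
    p q : Fin (2 + m) → Bool
    p i = ⌊ pairFirstTwo τ (pairFirstTwo τ i) ≟ i ⌋ ∧ not ⌊ pairFirstTwo τ i ≟ i ⌋
    q i = lookup u i ∼⟨ G ⟩ lookup u (pairFirstTwo τ i)

  matched-part : (v ∼⟨ G ⟩ v′) ≡ true →
                 ⨁ (allFuns (2 + m) (2 + m)) (λ σ → weight G u σ ∧ matched σ) ≡ pm G vs
  matched-part v∼v′ = ⨁-reindex (∧-ext (weight-ext G u) matched-ext) (weight-ext G vs) record
    { to        = dropFirstTwo
    ; from      = pairFirstTwo
    ; to-cong   = λ σ≗σ′ i → cong (λ x → shiftDown x i) (σ≗σ′ (suc (suc i)))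
    ; from-cong = λ { τ≗τ′ zero → refl ; τ≗τ′ (suc zero) → refl
                    ; τ≗τ′ (suc (suc i)) → cong (λ z → suc (suc z)) (τ≗τ′ i) }
    ; to-supp   = λ σ supp → trans (sym (weight-pairFirstTwo v∼v′ (dropFirstTwo σ)))
                                   (trans (weight-ext G u (restrict-extend σ supp)) (∧-conicalˡ _ _ supp))
    ; from-supp = λ τ supp → ∧-intro (trans (weight-pairFirstTwo v∼v′ τ) supp) refl
    ; from∘to   = restrict-extend
    ; to∘from   = λ τ _ i → refl
    }
    where
    restrict-extend : ∀ σ → weight G u σ ∧ matched σ ≡ true → pairFirstTwo (dropFirstTwo σ) ≗ σ
    restrict-extend σ supp = pairFirstTwo-drop (∧-conicalˡ _ _ (∧-conicalˡ _ _ supp))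
      (⌊⌋-sound (σ zero ≟ suc zero) (∧-conicalʳ _ _ supp))

  module _ (twins : ∀ x → (v ∼⟨ G ⟩ x) ≡ (v′ ∼⟨ G ⟩ x)) where
    exchange-twins : Relabelling (v′ ∷ v ∷ vs) u
    exchange-twins = record
      { π = swap₀₁ ; ρ = swap₀₁ ; π∘ρ = swap₀₁-involutive ; ρ∘π = swap₀₁-involutive
      ; lookup-π = λ { zero → refl ; (suc zero) → refl ; (suc (suc i)) → refl } }

    weight-exchange : ∀ σ → weight G u (swap₀₁ ∘ σ ∘ swap₀₁) ≡ weight G u σ
    weight-exchange σ = trans (sym (weight-closed-nbhd G u (v′ ∷ v ∷ vs) same-nbhd (swap₀₁ ∘ σ ∘ swap₀₁)))
                              (weight-relabel G exchange-twins σ)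
      where
      same-nbhd : ∀ i x → (lookup (v′ ∷ v ∷ vs) i ∼⟨ G ⟩ x) ≡ (lookup u i ∼⟨ G ⟩ x)
      same-nbhd zero          x = sym (twins x)
      same-nbhd (suc zero)    x = twins x
      same-nbhd (suc (suc i)) x = refl

    -- The pairings not matching v with v′ cancel in pairs: exchanging the
    -- partners of v and v′ swaps which of the two partners is smaller.
    unmatched-part : ⨁ (allFuns (2 + m) (2 + m)) (λ σ → weight G u σ ∧ not (matched σ)) ≡ false
    unmatched-part = ⨁-cancel
      (∧-ext (weight-ext G u) (λ σ≗τ → cong not (matched-ext σ≗τ)))
      (λ σ≗τ → cong₂ (λ a b → ⌊ a <? b ⌋) (σ≗τ zero) (σ≗τ (suc zero)))
      record
        { ι            = λ σ → swap₀₁ ∘ σ ∘ swap₀₁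
        ; ι-cong       = λ σ≗σ′ i → cong swap₀₁ (σ≗σ′ (swap₀₁ i))
        ; ι-involutive = λ σ _ i → trans (swap₀₁-involutive _) (cong σ (swap₀₁-involutive i))
        ; ι-supp       = λ σ supp → ∧-intro (trans (weight-exchange σ) (∧-conicalˡ _ _ supp))
                                            (cong not (still-unmatched σ supp))
        ; ι-flips      = λ σ supp → let open OutsidePartners (partners σ supp) in
            trans (cong₂ (λ a b → ⌊ a <? b ⌋) second-fixed first-fixed) (<?-flip distinct)
        }
      where
      partners : ∀ σ → weight G u σ ∧ not (matched σ) ≡ true → OutsidePartners σ
      partners σ supp = outside-partners (∧-conicalˡ _ _ (∧-conicalˡ _ _ supp))
        λ σ0≡1 → contradiction (trans (sym (cong not (⌊⌋-yes (σ zero ≟ suc zero) σ0≡1)))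
                                      (∧-conicalʳ _ _ supp)) (λ ())
      still-unmatched : ∀ σ → weight G u σ ∧ not (matched σ) ≡ true →
                        matched (swap₀₁ ∘ σ ∘ swap₀₁) ≡ false
      still-unmatched σ supp = let open OutsidePartners (partners σ supp) in
        ⌊⌋-no (swap₀₁ (σ (suc zero)) ≟ suc zero) λ e → second-not-1 (trans (sym second-fixed) e)

    pm-twins-front : pm G u ≡ pm G vs
    pm-twins-front = begin
      pm G u                                          ≡⟨ ⨁-cong L (λ σ → split-by (weight G u σ) (matched σ)) ⟩
      ⨁ L (λ σ → on σ xor off σ)                      ≡⟨ ⨁-xor L on off ⟩
      ⨁ L on xor ⨁ L off                              ≡⟨ cong₂ _xor_ (matched-part v∼v′) unmatched-part ⟩
      pm G vs xor false                               ≡⟨ xor-identityʳ (pm G vs) ⟩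
      pm G vs                                         ∎
      where
      open ≡-Reasoning
      L = allFuns (2 + m) (2 + m)
      on off : Fun (2 + m) (2 + m) → Bool
      on  σ = weight G u σ ∧ matched σ
      off σ = weight G u σ ∧ not (matched σ)
      v∼v′ : (v ∼⟨ G ⟩ v′) ≡ true
      v∼v′ = trans (twins v′) (∼-refl G v′)

lemma4 : ∀ {N : ℕ} (G : SimpleGraph N) (n : ℕ) → 2 ≤ n → Even n →
         (vs : Vec (Fin N) (n ∸ 2)) (v v′ : Fin N) →
         (∀ (x : Fin N) → (v ∼⟨ G ⟩ x) ≡ (v′ ∼⟨ G ⟩ x)) →
         pm G (vs ++ (v ∷ v′ ∷ [])) ≡ pm G vs
lemma4 G n _ _ vs v v′ twins = begin
  pm G (vs ++ (v ∷ v′ ∷ []))  ≡⟨ sym (pm-relabel G (++-swap (v ∷ v′ ∷ []) vs)) ⟩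
  pm G (v ∷ v′ ∷ vs)          ≡⟨ Twins.pm-twins-front G vs v v′ twins ⟩
  pm G vs                     ∎
  where open ≡-Reasoning
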